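{- Let $G$ be a finite simple connected graph with threshold function $\theta:V(G)\to\mathbb{Z}$, and suppose $v$ is a cut-vertex of $G$ such that $G=G_1\oplus_v G_2$. Define the threshold function $\theta_1$ on $G_1-v$ by $\theta_1(x)=\theta(x)-1$ for $x\in N_{G_1}(v)$ and $\theta_1(x)=\theta(x)$ for all other $x\in V(G_1-v)$. Let $S_1$ be an optimal target set for $(G_1-v,\theta_1)$ which, among all optimal target sets for $(G_1-v,\theta_1)$, maximizes $|N_{G_1}(v)\cap [S_1]^{G_1}_\theta|$, where $\theta$ also denotes the restriction of $\theta$ to $V(G_1)$. Define $\theta_2$ on $G_2$ by $\theta_2(v)=\theta(v)-|N_{G_1}(v)\cap [S_1]^{G_1}_\theta|$ and $\theta_2(x)=\theta(x)$ for $x\in V(G_2)\setminus\{v\}$. Let $S_2$ be an optimal target set for $(G_2,\theta_2)$. Then $S_1\cup S_2$ is an optimal target set for $(G,\theta)$.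
   Context: A social network $(H,\theta)$ is a finite simple graph $H$ with a threshold function $\theta:V(H)\to\mathbb{Z}$. For a target set $S\subseteq V(H)$, the activation process is: at time $0$ the vertices of $S$ are active and all others inactive; at each subsequent time step, every inactive vertex $u$ having at least $\theta(u)$ active neighbours becomes active (so an inactive vertex with $\theta(u)\le 0$ becomes active at the next step). The process stops when no more vertices become active; $[S]^H_\theta$ denotes the set of active vertices at the end. $\text{min-seed}(H,\theta)=\min\{|S|: S\subseteq V(H),\ [S]^H_\theta=V(H)\}$, and an optimal target set for $(H,\theta)$ is a set $S$ with $[S]^H_\theta=V(H)$ and $|S|=\text{min-seed}(H,\theta)$. For a cut-vertex $v$ of $G$: if $G-v$ is the disjoint union of two graphs $W_1,W_2$ and $G_i$ is the subgraph of $G$ induced by $\{v\}\cup V(W_i)$ ($i=1,2$), then $G$ is called the vertex-sum of $G_1$ and $G_2$ at $v$, written $G=G_1\oplus_v G_2$. $N_{H}(v)$ is the neighbourhood of $v$ in $H$, and $G_1-v$ is the subgraph induced by $V(G_1)\setminus\{v\}$. -}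

module Defs where

open import Data.Bool using (Bool; true; false; _∧_; _∨_)
open import Data.Nat using (ℕ; zero; suc) renaming (_≤_ to _≤ℕ_)
open import Data.Integer using (ℤ; +_; _-_; _≤?_)
open import Data.Fin using (Fin; _≟_)
open import Data.Fin.Subset using (Subset; _∈_; _∉_; _⊆_; _∩_; _∪_; ∣_∣; ⁅_⁆; ⊤; ⊥; Nonempty)
open import Data.Vec using (tabulate; lookup)
open import Data.Product using (_×_; Σ)
open import Data.Sum using (_⊎_)
open import Relation.Binary.PropositionalEquality using (_≡_; _≢_)
open import Relation.Nullary.Decidable using (⌊_⌋; yes; no)

record Graph (n : ℕ) : Set where
  field
    adj    : Fin n → Fin n → Bool
    sym    : ∀ x y → adj x y ≡ adj y x
    irrefl : ∀ x → adj x x ≡ false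
open Graph public

data Reach {n : ℕ} (G : Graph n) : Fin n → Fin n → Set where
  here : ∀ {x} → Reach G x x
  there : ∀ {x y z} → adj G x y ≡ true → Reach G y z → Reach G x z

Connected : ∀ {n} → Graph n → Set
Connected G = ∀ x y → Reach G x y

Threshold : ℕ → Set
Threshold n = Fin n → ℤ

nbrs : ∀ {n} → Graph n → Subset n → Fin n → Subset n
nbrs G U u = tabulate λ w → lookup U w ∧ adj G u w

step : ∀ {n} → Graph n → Subset n → Threshold n → Subset n → Subset n
step G U θ A = tabulate λ u →
  lookup A u ∨ (lookup U u ∧ ⌊ θ u ≤? + ∣ nbrs G U u ∩ A ∣ ⌋)

iter : ∀ {n} → ℕ → (Subset n → Subset n) → Subset n → Subset n
iter zero    f A = A
iter (suc k) f A = f (iter k f A)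

-- [S]^{G[U]}_θ : the final active set. The process is monotone and each
-- non-final step activates at least one new vertex, so it stabilises
-- after at most n steps.
closure : ∀ {n} → Graph n → Subset n → Threshold n → Subset n → Subset n
closure {n} G U θ S = iter n (step G U θ) S

IsTargetSet : ∀ {n} → Graph n → Subset n → Threshold n → Subset n → Set
IsTargetSet G U θ S = S ⊆ U × closure G U θ S ≡ U

IsOptimal : ∀ {n} → Graph n → Subset n → Threshold n → Subset n → Set
IsOptimal G U θ S =
  IsTargetSet G U θ S × (∀ T → IsTargetSet G U θ T → ∣ S ∣ ≤ℕ ∣ T ∣)

-- G = G₁ ⊕_v G₂ where G - v is the disjoint union of G[W₁] and G[W₂]
-- (both nonempty, since v is a cut-vertex), G₁ = G[{v} ∪ W₁], G₂ = G[{v} ∪ W₂].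
record VertexSum {n : ℕ} (G : Graph n) (v : Fin n) (W₁ W₂ : Subset n) : Set where
  field
    v∉W₁     : v ∉ W₁
    v∉W₂     : v ∉ W₂
    cover    : ∀ x → x ≢ v → x ∈ W₁ ⊎ x ∈ W₂
    disjoint : ∀ x → x ∈ W₁ → x ∉ W₂
    noEdge   : ∀ x y → x ∈ W₁ → y ∈ W₂ → adj G x y ≡ false
    ne₁      : Nonempty W₁
    ne₂      : Nonempty W₂

θ₁ : ∀ {n} → Graph n → Threshold n → Fin n → Threshold n
θ₁ G θ v x with adj G v x
... | true  = θ x - + 1
... | false = θ x

θ₂ : ∀ {n} → Threshold n → Fin n → ℕ → Threshold n
θ₂ θ v k x with x ≟ v
... | yes _ = θ x - + k
... | no  _ = θ x

module Submission where

-- The activation process on (G[U], θ) is monotone, so its final active set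
-- [S] is the least superset of S that is closed under the activation rule
-- (no vertex of U outside it has enough active neighbours in it).
-- Upper bound (union-activates): the final set of S₁ ∪ S₂ contains the run
-- of G₁ from S₁, so it gives v the K S₁ neighbours that θ₂ discounts; hence
-- it is closed for (G₂, θ₂), contains v, and then is closed for (G₁ - v, θ₁).
-- Lower bound (seeds-bound): a target set T of G splits into T ∩ W₁, a
-- target set for (G₁ - v, θ₁), and T ∩ U₂, which activates G₂ once v is
-- reached; comparing |T ∩ W₁| with |S₁| and using the maximality of K S₁
-- gives |S₁| + |S₂| ≤ |T|.

open import Defs hiding (sym; here; there)
open import Data.Bool using (Bool; true; false; _∧_; _∨_)
open import Data.Nat using (ℕ; zero; suc; s≤s; z≤n) renaming (_≤_ to _≤ℕ_; _<_ to _<ℕ_; _+_ to _+ℕ_)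
import Data.Nat.Properties as ℕP
open import Data.Integer using (+_; _-_; -_; _≤?_; +≤+) renaming (_≤_ to _≤ᶻ_; _+_ to _+ᶻ_)
import Data.Integer.Properties as ℤP
open import Data.Integer.Tactic.RingSolver using (solve-∀)
open import Data.Fin using (Fin)
import Data.Fin.Properties as FinP
open import Data.Fin.Subset using (Subset; _∈_; _∉_; _⊆_; _∩_; _∪_; ∣_∣; ⁅_⁆; ⊤)
open import Data.Fin.Subset.Properties
open import Data.Vec using (_∷_; []; tabulate; lookup; _[_]=_)
open _[_]=_ using (here; there)
open import Data.Vec.Properties using (lookup∘tabulate; []=⇒lookup; lookup⇒[]=)
open import Data.Product using (_×_; _,_; proj₁; proj₂)
open import Data.Sum using (_⊎_; inj₁; inj₂)
open import Data.Empty using (⊥-elim) renaming (⊥ to False)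
open import Relation.Nullary using (Dec; yes; no)
open import Relation.Nullary.Decidable using (⌊_⌋; _×-dec_; ¬?)
open import Relation.Binary.PropositionalEquality
  using (_≡_; _≢_; refl; trans; cong; subst; subst₂) renaming (sym to ≡-sym)

private variable
  n : ℕ

∈-tabulate⁻ : (f : Fin n → Bool) {x : Fin n} → x ∈ tabulate f → f x ≡ true
∈-tabulate⁻ f {x} x∈ = trans (≡-sym (lookup∘tabulate f x)) ([]=⇒lookup x∈)

∈-tabulate⁺ : (f : Fin n → Bool) {x : Fin n} → f x ≡ true → x ∈ tabulate f
∈-tabulate⁺ f {x} fx = lookup⇒[]= x (tabulate f) (trans (lookup∘tabulate f x) fx)

∧-true⁻ : ∀ {a b} → a ∧ b ≡ true → a ≡ true × b ≡ true
∧-true⁻ {true} {true} _ = refl , refl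

∧-true⁺ : ∀ {a b} → a ≡ true → b ≡ true → a ∧ b ≡ true
∧-true⁺ refl refl = refl

∨-true⁻ : ∀ {a b} → a ∨ b ≡ true → a ≡ true ⊎ b ≡ true
∨-true⁻ {true}  _ = inj₁ refl
∨-true⁻ {false} h = inj₂ h

∨-true⁺ : ∀ {a b} → a ≡ true ⊎ b ≡ true → a ∨ b ≡ true
∨-true⁺ {true}  _          = refl
∨-true⁺ {false} (inj₂ h)   = h

⌊⌋-true⁻ : ∀ {P : Set} (d : Dec P) → ⌊ d ⌋ ≡ true → P
⌊⌋-true⁻ (yes p) _ = p

⌊⌋-true⁺ : ∀ {P : Set} (d : Dec P) → P → ⌊ d ⌋ ≡ true
⌊⌋-true⁺ (yes _) _ = refl
⌊⌋-true⁺ (no ¬p) p = ⊥-elim (¬p p)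

∣∪∣≤ : (p q : Subset n) → ∣ p ∪ q ∣ ≤ℕ ∣ p ∣ +ℕ ∣ q ∣
∣∪∣≤ []          []          = z≤n
∣∪∣≤ (true  ∷ p) (true  ∷ q) = s≤s (ℕP.≤-trans (∣∪∣≤ p q) (ℕP.≤-trans (ℕP.n≤1+n _) (ℕP.≤-reflexive (≡-sym (ℕP.+-suc ∣ p ∣ ∣ q ∣)))))
∣∪∣≤ (true  ∷ p) (false ∷ q) = s≤s (∣∪∣≤ p q)
∣∪∣≤ (false ∷ p) (true  ∷ q) = ℕP.≤-trans (s≤s (∣∪∣≤ p q)) (ℕP.≤-reflexive (≡-sym (ℕP.+-suc ∣ p ∣ ∣ q ∣)))
∣∪∣≤ (false ∷ p) (false ∷ q) = ∣∪∣≤ p q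

∣∪∣≥ : (p q : Subset n) → (∀ {x} → x ∈ p → x ∈ q → False) → ∣ p ∣ +ℕ ∣ q ∣ ≤ℕ ∣ p ∪ q ∣
∣∪∣≥ []          []          _ = z≤n
∣∪∣≥ (true  ∷ p) (true  ∷ q) d = ⊥-elim (d here here)
∣∪∣≥ (true  ∷ p) (false ∷ q) d = s≤s (∣∪∣≥ p q λ a b → d (there a) (there b))
∣∪∣≥ (false ∷ p) (true  ∷ q) d =
  ℕP.≤-trans (ℕP.≤-reflexive (ℕP.+-suc ∣ p ∣ ∣ q ∣)) (s≤s (∣∪∣≥ p q λ a b → d (there a) (there b)))
∣∪∣≥ (false ∷ p) (false ∷ q) d = ∣∪∣≥ p q λ a b → d (there a) (there b)

shift⁻ : ∀ i k m → i - + k ≤ᶻ + m → i ≤ᶻ + (k +ℕ m)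
shift⁻ i k m h =
  subst₂ _≤ᶻ_ (cancel i (+ k)) (trans (ℤP.+-comm (+ m) (+ k)) (≡-sym (ℤP.pos-+ k m)))
         (ℤP.+-mono-≤ h (ℤP.≤-refl {+ k}))
  where
  cancel : ∀ i j → (i - j) +ᶻ j ≡ i
  cancel = solve-∀

shift⁺ : ∀ i k m → i ≤ᶻ + (k +ℕ m) → i - + k ≤ᶻ + m
shift⁺ i k m h =
  subst (i - + k ≤ᶻ_) (trans (cong (_- + k) (ℤP.pos-+ k m)) (cancel (+ k) (+ m)))
        (ℤP.+-mono-≤ h (ℤP.≤-refl { - + k }))
  where
  cancel : ∀ j m → (j +ᶻ m) - j ≡ m
  cancel = solve-∀

raise : ∀ {i a b} → i ≤ᶻ + a → a ≤ℕ b → i ≤ᶻ + b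
raise i≤a a≤b = ℤP.≤-trans i≤a (+≤+ a≤b)

active : Graph n → Subset n → Fin n → Subset n → ℕ
active G U u A = ∣ nbrs G U u ∩ A ∣

∈-active⁻ : ∀ (G : Graph n) U u A {w} → w ∈ nbrs G U u ∩ A → adj G u w ≡ true × w ∈ U × w ∈ A
∈-active⁻ G U u A w∈ with x∈p∩q⁻ (nbrs G U u) A w∈
... | w∈N , w∈A with ∧-true⁻ (∈-tabulate⁻ (λ w → lookup U w ∧ adj G u w) w∈N)
...   | w∈U , u~w = u~w , lookup⇒[]= _ U w∈U , w∈A

∈-active⁺ : ∀ (G : Graph n) U u A {w} → adj G u w ≡ true → w ∈ U → w ∈ A → w ∈ nbrs G U u ∩ A
∈-active⁺ G U u A u~w w∈U w∈A =
  x∈p∩q⁺ (∈-tabulate⁺ (λ w → lookup U w ∧ adj G u w) (∧-true⁺ ([]=⇒lookup w∈U) u~w) , w∈A)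

counted-⊆ : ∀ (G : Graph n) {U A U' A' u}
  → (∀ {w} → adj G u w ≡ true → w ∈ U → w ∈ A → w ∈ U' × w ∈ A')
  → nbrs G U u ∩ A ⊆ nbrs G U' u ∩ A'
counted-⊆ G {U} {A} {U'} {A'} {u} moves w∈ with ∈-active⁻ G U u A w∈
... | u~w , w∈U , w∈A with moves u~w w∈U w∈A
...   | w∈U' , w∈A' = ∈-active⁺ G U' u A' u~w w∈U' w∈A'

active-local : ∀ (G : Graph n) {U A U' A' u}
  → (∀ {w} → adj G u w ≡ true → w ∈ U → w ∈ A → w ∈ U' × w ∈ A')
  → active G U u A ≤ℕ active G U' u A'
active-local G moves = p⊆q⇒∣p∣≤∣q∣ (counted-⊆ G moves)

active-split : ∀ (G : Graph n) {U A U₁ A₁ U₂ A₂ u}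
  → (∀ {w} → adj G u w ≡ true → w ∈ U → w ∈ A → (w ∈ U₁ × w ∈ A₁) ⊎ (w ∈ U₂ × w ∈ A₂))
  → active G U u A ≤ℕ active G U₁ u A₁ +ℕ active G U₂ u A₂
active-split G {U} {A} {U₁} {A₁} {U₂} {A₂} {u} splits =
  ℕP.≤-trans (p⊆q⇒∣p∣≤∣q∣ incl) (∣∪∣≤ (nbrs G U₁ u ∩ A₁) (nbrs G U₂ u ∩ A₂))
  where
  incl : nbrs G U u ∩ A ⊆ (nbrs G U₁ u ∩ A₁) ∪ (nbrs G U₂ u ∩ A₂)
  incl w∈ with ∈-active⁻ G U u A w∈
  ... | u~w , w∈U , w∈A with splits u~w w∈U w∈A
  ...   | inj₁ (w∈U₁ , w∈A₁) = x∈p∪q⁺ (inj₁ (∈-active⁺ G U₁ u A₁ u~w w∈U₁ w∈A₁))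
  ...   | inj₂ (w∈U₂ , w∈A₂) = x∈p∪q⁺ (inj₂ (∈-active⁺ G U₂ u A₂ u~w w∈U₂ w∈A₂))

active-join : ∀ (G : Graph n) {U₁ U₂ U A u}
  → (∀ {w} → adj G u w ≡ true → w ∈ U₁ → w ∈ U₂ → False) → U₁ ⊆ U → U₂ ⊆ U
  → active G U₁ u A +ℕ active G U₂ u A ≤ℕ active G U u A
active-join G {U₁} {U₂} {U} {A} {u} apart U₁⊆U U₂⊆U =
  ℕP.≤-trans (∣∪∣≥ (nbrs G U₁ u ∩ A) (nbrs G U₂ u ∩ A) disjoint) (p⊆q⇒∣p∣≤∣q∣ incl)
  where
  disjoint : ∀ {w} → w ∈ nbrs G U₁ u ∩ A → w ∈ nbrs G U₂ u ∩ A → False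
  disjoint w∈₁ w∈₂ with ∈-active⁻ G U₁ u A w∈₁ | ∈-active⁻ G U₂ u A w∈₂
  ... | u~w , w∈U₁ , _ | _ , w∈U₂ , _ = apart u~w w∈U₁ w∈U₂
  incl : (nbrs G U₁ u ∩ A) ∪ (nbrs G U₂ u ∩ A) ⊆ nbrs G U u ∩ A
  incl w∈ with x∈p∪q⁻ (nbrs G U₁ u ∩ A) (nbrs G U₂ u ∩ A) w∈
  ... | inj₁ w∈₁ = counted-⊆ G (λ _ w∈U₁ w∈A → U₁⊆U w∈U₁ , w∈A) w∈₁
  ... | inj₂ w∈₂ = counted-⊆ G (λ _ w∈U₂ w∈A → U₂⊆U w∈U₂ , w∈A) w∈₂

active-≤⊤ : ∀ (G : Graph n) U {A u} → active G U u A ≤ℕ active G ⊤ u A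
active-≤⊤ G U {A} = active-local G {U} {A} (λ _ _ w∈A → ∈⊤ , w∈A)

active-⁅⁆-≤ : ∀ (G : Graph n) x u A → active G ⁅ x ⁆ u A ≤ℕ 1
active-⁅⁆-≤ G x u A =
  subst (active G ⁅ x ⁆ u A ≤ℕ_) (∣⁅x⁆∣≡1 x)
        (p⊆q⇒∣p∣≤∣q∣ λ w∈ → proj₁ (proj₂ (∈-active⁻ G ⁅ x ⁆ u A w∈)))

active-⁅⁆-≥ : ∀ (G : Graph n) {x u A} → adj G u x ≡ true → x ∈ A → 1 ≤ℕ active G ⁅ x ⁆ u A
active-⁅⁆-≥ G {x} {u} {A} u~x x∈A = subst (_≤ℕ active G ⁅ x ⁆ u A) (∣⁅x⁆∣≡1 x) (p⊆q⇒∣p∣≤∣q∣ incl)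
  where
  incl : ⁅ x ⁆ ⊆ nbrs G ⁅ x ⁆ u ∩ A
  incl w∈ with x∈⁅y⁆⇒x≡y x w∈
  ... | refl = ∈-active⁺ G ⁅ x ⁆ u A u~x w∈ x∈A

module Activation {n} (G : Graph n) (U : Subset n) (θ : Threshold n) where

  Closed : Subset n → Set
  Closed C = ∀ u → u ∈ U → θ u ≤ᶻ + active G U u C → u ∈ C

  ∈-step⁻ : ∀ {A u} → u ∈ step G U θ A → u ∈ A ⊎ (u ∈ U × θ u ≤ᶻ + active G U u A)
  ∈-step⁻ {A} {u} u∈ with ∨-true⁻ (∈-tabulate⁻ _ u∈)
  ... | inj₁ u∈A = inj₁ (lookup⇒[]= u A u∈A)
  ... | inj₂ rule with ∧-true⁻ rule
  ...   | u∈U , enough = inj₂ (lookup⇒[]= u U u∈U , ⌊⌋-true⁻ (θ u ≤? _) enough)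

  ∈-step⁺ : ∀ {A u} → u ∈ A ⊎ (u ∈ U × θ u ≤ᶻ + active G U u A) → u ∈ step G U θ A
  ∈-step⁺ {A} {u} h = ∈-tabulate⁺ _ (∨-true⁺ (rule h))
    where
    rule : u ∈ A ⊎ (u ∈ U × θ u ≤ᶻ + active G U u A)
         → lookup A u ≡ true ⊎ lookup U u ∧ ⌊ θ u ≤? + active G U u A ⌋ ≡ true
    rule (inj₁ u∈A)            = inj₁ ([]=⇒lookup u∈A)
    rule (inj₂ (u∈U , enough)) = inj₂ (∧-true⁺ ([]=⇒lookup u∈U) (⌊⌋-true⁺ (θ u ≤? _) enough))

  active-monoʳ : ∀ {u A B} → A ⊆ B → active G U u A ≤ℕ active G U u B
  active-monoʳ {u} {A} {B} A⊆B = active-local G {U} {A} {U} {B} (λ _ w∈U w∈A → w∈U , A⊆B w∈A)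

  step-inflationary : ∀ {A} → A ⊆ step G U θ A
  step-inflationary u∈A = ∈-step⁺ (inj₁ u∈A)

  step-mono : ∀ {A B} → A ⊆ B → step G U θ A ⊆ step G U θ B
  step-mono A⊆B u∈ with ∈-step⁻ u∈
  ... | inj₁ u∈A            = ∈-step⁺ (inj₁ (A⊆B u∈A))
  ... | inj₂ (u∈U , enough) = ∈-step⁺ (inj₂ (u∈U , raise enough (active-monoʳ A⊆B)))

  ⊆-iter : ∀ {S} j → S ⊆ iter j (step G U θ) S
  ⊆-iter zero    = λ u∈S → u∈S
  ⊆-iter (suc j) = λ u∈S → step-inflationary (⊆-iter j u∈S)

  iter-⊆-closed : ∀ {C S} → Closed C → S ⊆ C → ∀ j → iter j (step G U θ) S ⊆ C
  iter-⊆-closed C-closed S⊆C zero    u∈ = S⊆C u∈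
  iter-⊆-closed C-closed S⊆C (suc j) u∈ with ∈-step⁻ u∈
  ... | inj₁ u∈prev           = iter-⊆-closed C-closed S⊆C j u∈prev
  ... | inj₂ (u∈U , enough) =
    C-closed _ u∈U (raise enough (active-monoʳ (iter-⊆-closed C-closed S⊆C j)))

  Stable : Subset n → Set
  Stable A = step G U θ A ⊆ A

  stable-or-grows : ∀ A → Stable A ⊎ ∣ A ∣ <ℕ ∣ step G U θ A ∣
  stable-or-grows A with FinP.any? (λ x → (x ∈? step G U θ A) ×-dec ¬? (x ∈? A))
  ... | yes (x , x∈next , x∉A) = inj₂ (p⊂q⇒∣p∣<∣q∣ (step-inflationary , x , x∈next , x∉A))
  ... | no nothing-new = inj₁ stable
    where
    stable : Stable A
    stable {x} x∈next with x ∈? A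
    ... | yes x∈A = x∈A
    ... | no  x∉A = ⊥-elim (nothing-new (x , x∈next , x∉A))

  iter-progress : ∀ S j → Stable (iter j (step G U θ) S) ⊎ j ≤ℕ ∣ iter j (step G U θ) S ∣
  iter-progress S zero = inj₂ z≤n
  iter-progress S (suc j) with iter-progress S j
  ... | inj₁ stable = inj₁ (step-mono stable)
  ... | inj₂ j≤∣A∣ with stable-or-grows (iter j (step G U θ) S)
  ...   | inj₁ stable = inj₁ (step-mono stable)
  ...   | inj₂ grows  = inj₂ (ℕP.≤-trans (s≤s j≤∣A∣) grows)

  closure-stable : ∀ S → Stable (closure G U θ S)
  closure-stable S with iter-progress S n
  ... | inj₁ stable = stable
  ... | inj₂ n≤∣C∣  =
    subst Stable (≡-sym (∣p∣≡n⇒p≡⊤ (ℕP.≤-antisym (∣p∣≤n (closure G U θ S)) n≤∣C∣))) ⊆⊤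

  closure-closed : ∀ S → Closed (closure G U θ S)
  closure-closed S u u∈U enough = closure-stable S (∈-step⁺ (inj₂ (u∈U , enough)))

  ⊆-closure : ∀ S → S ⊆ closure G U θ S
  ⊆-closure S = ⊆-iter n

  closure-least : ∀ {C S} → Closed C → S ⊆ C → closure G U θ S ⊆ C
  closure-least C-closed S⊆C = iter-⊆-closed C-closed S⊆C n

  closure-⊆ : ∀ {S} → S ⊆ U → closure G U θ S ⊆ U
  closure-⊆ = closure-least (λ _ u∈U _ → u∈U)

θ₂-at : ∀ θ (v : Fin n) k {i} → θ v - + k ≤ᶻ i → θ₂ θ v k v ≤ᶻ i
θ₂-at θ v k h with v FinP.≟ v
... | yes _   = h
... | no  v≢v = ⊥-elim (v≢v refl)

θ₂-off : ∀ θ (v : Fin n) k {x i} → x ≢ v → θ x ≤ᶻ i → θ₂ θ v k x ≤ᶻ i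
θ₂-off θ v k {x} x≢v h with x FinP.≟ v
... | yes x≡v = ⊥-elim (x≢v x≡v)
... | no  _   = h

true≢false : ∀ {b} → b ≡ true → b ≡ false → False
true≢false refl ()

module VertexSumGeometry {n} {G : Graph n} {v : Fin n} {W₁ W₂ : Subset n}
                         (VS : VertexSum G v W₁ W₂) where
  open VertexSum VS

  U₁ U₂ : Subset n
  U₁ = ⁅ v ⁆ ∪ W₁
  U₂ = ⁅ v ⁆ ∪ W₂

  v∈⁅v⁆∪ : ∀ W → v ∈ ⁅ v ⁆ ∪ W
  v∈⁅v⁆∪ W = x∈p∪q⁺ (inj₁ (x∈⁅x⁆ v))

  W⊆⁅v⁆∪ : ∀ W → W ⊆ ⁅ v ⁆ ∪ W
  W⊆⁅v⁆∪ W x∈W = x∈p∪q⁺ (inj₂ x∈W)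

  ∈⁅v⁆∪⁻ : ∀ W {x} → x ∈ ⁅ v ⁆ ∪ W → x ≡ v ⊎ x ∈ W
  ∈⁅v⁆∪⁻ W {x} x∈ with x∈p∪q⁻ ⁅ v ⁆ W x∈
  ... | inj₁ x∈⁅v⁆ = inj₁ (x∈⁅y⁆⇒x≡y v x∈⁅v⁆)
  ... | inj₂ x∈W   = inj₂ x∈W

  location : ∀ x → x ≡ v ⊎ (x ∈ W₁ ⊎ x ∈ W₂)
  location x with x FinP.≟ v
  ... | yes x≡v = inj₁ x≡v
  ... | no  x≢v = inj₂ (cover x x≢v)

  W₂-≢v : ∀ {x} → x ∈ W₂ → x ≢ v
  W₂-≢v x∈W₂ refl = v∉W₂ x∈W₂

  W₁∉U₂ : ∀ {x} → x ∈ W₁ → x ∉ U₂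
  W₁∉U₂ {x} x∈W₁ x∈U₂ with ∈⁅v⁆∪⁻ W₂ x∈U₂
  ... | inj₁ refl  = v∉W₁ x∈W₁
  ... | inj₂ x∈W₂ = disjoint x x∈W₁ x∈W₂

  U₁∩U₂ : ∀ {x} → x ∈ U₁ → x ∈ U₂ → x ≡ v
  U₁∩U₂ x∈U₁ x∈U₂ with ∈⁅v⁆∪⁻ W₁ x∈U₁
  ... | inj₁ x≡v  = x≡v
  ... | inj₂ x∈W₁ = ⊥-elim (W₁∉U₂ x∈W₁ x∈U₂)

  nbr-W₁ : ∀ {u w} → u ∈ W₁ → adj G u w ≡ true → w ∈ U₁
  nbr-W₁ {u} {w} u∈W₁ u~w with location w
  ... | inj₁ refl         = v∈⁅v⁆∪ W₁
  ... | inj₂ (inj₁ w∈W₁) = W⊆⁅v⁆∪ W₁ w∈W₁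
  ... | inj₂ (inj₂ w∈W₂) = ⊥-elim (true≢false u~w (noEdge u w u∈W₁ w∈W₂))

  nbr-W₂ : ∀ {u w} → u ∈ W₂ → adj G u w ≡ true → w ∈ U₂
  nbr-W₂ {u} {w} u∈W₂ u~w with location w
  ... | inj₁ refl         = v∈⁅v⁆∪ W₂
  ... | inj₂ (inj₂ w∈W₂) = W⊆⁅v⁆∪ W₂ w∈W₂
  ... | inj₂ (inj₁ w∈W₁) =
    ⊥-elim (true≢false (trans (Graph.sym G w u) u~w) (noEdge w u w∈W₁ u∈W₂))

module VertexSumTargets {n} (G : Graph n) (θ : Threshold n) (v : Fin n) (W₁ W₂ : Subset n)
                        (VS : VertexSum G v W₁ W₂) where
  open VertexSum VS
  open VertexSumGeometry VS

  module Whole        = Activation G ⊤ θ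
  module Side₁        = Activation G U₁ θ
  module Inner        = Activation G W₁ (θ₁ G θ v)
  module Side₂ (k : ℕ) = Activation G U₂ (θ₂ θ v k)

  K : Subset n → ℕ
  K S = active G U₁ v (closure G U₁ θ S)

  -- Its final active set C contains the
  -- run of G₁ from S₁, so C is closed for (G₂, θ₂) and contains U₂; once v
  -- is active, C is closed for (G₁ - v, θ₁) and contains W₁.
  union-activates : ∀ {S₁ S₂} → closure G W₁ (θ₁ G θ v) S₁ ≡ W₁
    → closure G U₂ (θ₂ θ v (K S₁)) S₂ ≡ U₂ → closure G ⊤ θ (S₁ ∪ S₂) ≡ ⊤
  union-activates {S₁} {S₂} clS₁ clS₂ = ⊆-antisym ⊆⊤ (λ {x} _ → everywhere x)
    where
    C : Subset n
    C = closure G ⊤ θ (S₁ ∪ S₂)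

    C-closed : Whole.Closed C
    C-closed = Whole.closure-closed (S₁ ∪ S₂)

    S₁⊆C : S₁ ⊆ C
    S₁⊆C x∈S₁ = Whole.⊆-closure (S₁ ∪ S₂) (p⊆p∪q S₂ x∈S₁)

    S₂⊆C : S₂ ⊆ C
    S₂⊆C x∈S₂ = Whole.⊆-closure (S₁ ∪ S₂) (q⊆p∪q S₁ S₂ x∈S₂)

    G₁-run⊆C : closure G U₁ θ S₁ ⊆ C
    G₁-run⊆C = Side₁.closure-least (λ u _ enough → C-closed u ∈⊤ (raise enough (active-≤⊤ G U₁))) S₁⊆C

    -- At v the reduction K S₁ is paid for by v's active neighbours in G₁
    -- (matching on u ≟ v unfolds θ₂ in the hypothesis).
    C-closed₂ : Side₂.Closed (K S₁) C
    C-closed₂ u u∈U₂ enough with u FinP.≟ v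
    ... | yes refl = C-closed v ∈⊤ (raise (shift⁻ (θ v) (K S₁) _ enough) (
            ℕP.≤-trans (ℕP.+-monoˡ-≤ _ (Side₁.active-monoʳ G₁-run⊆C)) (active-join G apart ⊆⊤ ⊆⊤)))
      where
      apart : ∀ {w} → adj G v w ≡ true → w ∈ U₁ → w ∈ U₂ → False
      apart v~w w∈U₁ w∈U₂ with U₁∩U₂ w∈U₁ w∈U₂
      ... | refl = true≢false v~w (irrefl G v)
    ... | no _ = C-closed u ∈⊤ (raise enough (active-≤⊤ G U₂))

    U₂⊆C : U₂ ⊆ C
    U₂⊆C = subst (_⊆ C) clS₂ (Side₂.closure-least (K S₁) C-closed₂ S₂⊆C)

    v∈C : v ∈ C
    v∈C = U₂⊆C (v∈⁅v⁆∪ W₂)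

    -- The reduction of θ₁ at a neighbour u of v is paid for by v itself
    -- (matching on adj G v u unfolds θ₁ in the hypothesis).
    C-closed-inner : Inner.Closed C
    C-closed-inner u u∈W₁ enough with adj G v u in v~u
    ... | true = C-closed u ∈⊤ (raise (shift⁻ (θ u) 1 _ enough)
                   (ℕP.≤-trans (ℕP.+-monoˡ-≤ _ (active-⁅⁆-≥ G (trans (Graph.sym G u v) v~u) v∈C))
                               (active-join G apart ⊆⊤ ⊆⊤)))
      where
      apart : ∀ {w} → adj G u w ≡ true → w ∈ ⁅ v ⁆ → w ∈ W₁ → False
      apart _ w∈⁅v⁆ w∈W₁ with x∈⁅y⁆⇒x≡y v w∈⁅v⁆
      ... | refl = v∉W₁ w∈W₁
    ... | false = C-closed u ∈⊤ (raise enough (active-≤⊤ G W₁))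

    W₁⊆C : W₁ ⊆ C
    W₁⊆C = subst (_⊆ C) clS₁ (Inner.closure-least C-closed-inner S₁⊆C)

    everywhere : ∀ x → x ∈ C
    everywhere x with location x
    ... | inj₁ refl         = v∈C
    ... | inj₂ (inj₁ x∈W₁) = W₁⊆C x∈W₁
    ... | inj₂ (inj₂ x∈W₂) = U₂⊆C (W⊆⁅v⁆∪ W₂ x∈W₂)

  -- Each claim is
  -- proved by exhibiting a closed set of (G, θ) containing T.
  module Restriction {T : Subset n} (clT : closure G ⊤ θ T ≡ ⊤) where

    T₁ T₂ : Subset n
    T₁ = T ∩ W₁
    T₂ = T ∩ U₂

    closed-is-all : ∀ {D} → Whole.Closed D → T ⊆ D → ∀ x → x ∈ D
    closed-is-all D-closed T⊆D x =
      Whole.closure-least D-closed T⊆D (subst (x ∈_) (≡-sym clT) ∈⊤)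

    T-split : ∀ {x} → x ∈ T → x ∈ T₁ ⊎ x ∈ T₂
    T-split {x} x∈T with location x
    ... | inj₁ refl         = inj₂ (x∈p∩q⁺ (x∈T , v∈⁅v⁆∪ W₂))
    ... | inj₂ (inj₁ x∈W₁) = inj₁ (x∈p∩q⁺ (x∈T , x∈W₁))
    ... | inj₂ (inj₂ x∈W₂) = inj₂ (x∈p∩q⁺ (x∈T , W⊆⁅v⁆∪ W₂ x∈W₂))

    ∣T₁∣+∣T₂∣≤∣T∣ : ∣ T₁ ∣ +ℕ ∣ T₂ ∣ ≤ℕ ∣ T ∣
    ∣T₁∣+∣T₂∣≤∣T∣ = ℕP.≤-trans (∣∪∣≥ T₁ T₂ λ x∈T₁ x∈T₂ → W₁∉U₂ (p∩q⊆q T W₁ x∈T₁) (p∩q⊆q T U₂ x∈T₂))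
                               (p⊆q⇒∣p∣≤∣q∣ T₁∪T₂⊆T)
      where
      T₁∪T₂⊆T : T₁ ∪ T₂ ⊆ T
      T₁∪T₂⊆T x∈ with x∈p∪q⁻ T₁ T₂ x∈
      ... | inj₁ x∈T₁ = p∩q⊆p T W₁ x∈T₁
      ... | inj₂ x∈T₂ = p∩q⊆p T U₂ x∈T₂

    -- T₁ activates G₁ - v under θ₁: the run D₁ from T₁, together with all of
    -- U₂, is closed in G, since a vertex of W₁ sees only v outside W₁.
    T₁-target : IsTargetSet G W₁ (θ₁ G θ v) T₁
    T₁-target = T₁⊆W₁ , ⊆-antisym (Inner.closure-⊆ T₁⊆W₁) W₁⊆D₁
      where
      T₁⊆W₁ : T₁ ⊆ W₁
      T₁⊆W₁ = p∩q⊆q T W₁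

      D₁ : Subset n
      D₁ = closure G W₁ (θ₁ G θ v) T₁

      in-D₁ : ∀ {w} → w ∈ W₁ → w ∈ D₁ ∪ U₂ → w ∈ D₁
      in-D₁ w∈W₁ w∈D with x∈p∪q⁻ D₁ U₂ w∈D
      ... | inj₁ w∈D₁ = w∈D₁
      ... | inj₂ w∈U₂ = ⊥-elim (W₁∉U₂ w∈W₁ w∈U₂)

      inner-enough : ∀ {u} → u ∈ W₁ → θ u ≤ᶻ + active G ⊤ u (D₁ ∪ U₂)
        → θ₁ G θ v u ≤ᶻ + active G W₁ u D₁
      inner-enough {u} u∈W₁ enough with adj G v u in v~u
      ... | true  = shift⁺ (θ u) 1 _ (raise enough
                      (ℕP.≤-trans (active-split G {⊤} {D₁ ∪ U₂} {⁅ v ⁆} {⊤} {W₁} {D₁} sides)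
                                  (ℕP.+-monoˡ-≤ _ (active-⁅⁆-≤ G v u ⊤))))
        where
        sides : ∀ {w} → adj G u w ≡ true → w ∈ ⊤ → w ∈ D₁ ∪ U₂
          → (w ∈ ⁅ v ⁆ × w ∈ ⊤) ⊎ (w ∈ W₁ × w ∈ D₁)
        sides u~w _ w∈D with ∈⁅v⁆∪⁻ W₁ (nbr-W₁ u∈W₁ u~w)
        ... | inj₁ refl  = inj₁ (x∈⁅x⁆ v , ∈⊤)
        ... | inj₂ w∈W₁ = inj₂ (w∈W₁ , in-D₁ w∈W₁ w∈D)
      ... | false = raise enough (active-local G {⊤} {D₁ ∪ U₂} {W₁} {D₁} inside)
        where
        inside : ∀ {w} → adj G u w ≡ true → w ∈ ⊤ → w ∈ D₁ ∪ U₂ → w ∈ W₁ × w ∈ D₁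
        inside u~w _ w∈D with ∈⁅v⁆∪⁻ W₁ (nbr-W₁ u∈W₁ u~w)
        ... | inj₁ refl  = ⊥-elim (true≢false (trans (Graph.sym G v u) u~w) v~u)
        ... | inj₂ w∈W₁ = w∈W₁ , in-D₁ w∈W₁ w∈D

      D-closed : Whole.Closed (D₁ ∪ U₂)
      D-closed u _ enough with location u
      ... | inj₁ refl         = q⊆p∪q D₁ U₂ (v∈⁅v⁆∪ W₂)
      ... | inj₂ (inj₂ u∈W₂) = q⊆p∪q D₁ U₂ (W⊆⁅v⁆∪ W₂ u∈W₂)
      ... | inj₂ (inj₁ u∈W₁) =
        p⊆p∪q U₂ (Inner.closure-closed T₁ u u∈W₁ (inner-enough u∈W₁ enough))

      T⊆D : T ⊆ D₁ ∪ U₂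
      T⊆D x∈T with T-split x∈T
      ... | inj₁ x∈T₁ = p⊆p∪q U₂ (Inner.⊆-closure T₁ x∈T₁)
      ... | inj₂ x∈T₂ = q⊆p∪q D₁ U₂ (p∩q⊆q T U₂ x∈T₂)

      W₁⊆D₁ : W₁ ⊆ D₁
      W₁⊆D₁ {x} x∈W₁ = in-D₁ x∈W₁ (closed-is-all D-closed T⊆D x)

    -- Any X ⊆ U₂ containing T₂ whose run in (G₂, θ₂) reaches v activates G₂:
    -- that run together with all of W₁ is closed in G, since a vertex of W₂
    -- sees only vertices of U₂.
    extend-T₂ : ∀ k {X} → X ⊆ U₂ → T₂ ⊆ X → v ∈ closure G U₂ (θ₂ θ v k) X
      → IsTargetSet G U₂ (θ₂ θ v k) X
    extend-T₂ k {X} X⊆U₂ T₂⊆X v∈D₂ = X⊆U₂ , ⊆-antisym (Side₂.closure-⊆ k X⊆U₂) U₂⊆D₂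
      where
      D₂ : Subset n
      D₂ = closure G U₂ (θ₂ θ v k) X

      in-D₂ : ∀ {w} → w ∈ U₂ → w ∈ D₂ ∪ W₁ → w ∈ D₂
      in-D₂ w∈U₂ w∈D with x∈p∪q⁻ D₂ W₁ w∈D
      ... | inj₁ w∈D₂ = w∈D₂
      ... | inj₂ w∈W₁ = ⊥-elim (W₁∉U₂ w∈W₁ w∈U₂)

      D-closed : Whole.Closed (D₂ ∪ W₁)
      D-closed u _ enough with location u
      ... | inj₁ refl         = p⊆p∪q W₁ v∈D₂
      ... | inj₂ (inj₁ u∈W₁) = q⊆p∪q D₂ W₁ u∈W₁
      ... | inj₂ (inj₂ u∈W₂) = p⊆p∪q W₁ (Side₂.closure-closed k X u (W⊆⁅v⁆∪ W₂ u∈W₂)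
          (θ₂-off θ v k (W₂-≢v u∈W₂)
                 (raise enough (active-local G {⊤} {D₂ ∪ W₁} {U₂} {D₂} inside))))
        where
        inside : ∀ {w} → adj G u w ≡ true → w ∈ ⊤ → w ∈ D₂ ∪ W₁ → w ∈ U₂ × w ∈ D₂
        inside u~w _ w∈D = nbr-W₂ u∈W₂ u~w , in-D₂ (nbr-W₂ u∈W₂ u~w) w∈D

      T⊆D : T ⊆ D₂ ∪ W₁
      T⊆D x∈T with T-split x∈T
      ... | inj₁ x∈T₁ = q⊆p∪q D₂ W₁ (p∩q⊆q T W₁ x∈T₁)
      ... | inj₂ x∈T₂ = p⊆p∪q W₁ (Side₂.⊆-closure k X (T₂⊆X x∈T₂))

      U₂⊆D₂ : U₂ ⊆ D₂
      U₂⊆D₂ {x} x∈U₂ = in-D₂ x∈U₂ (closed-is-all D-closed T⊆D x)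

    -- If v gets at most k active neighbours in G₁ from T₁, yet T₂ did not
    -- activate v in (G₂, θ₂ k), then the run D₂ of G₂ from T₂ together with
    -- the W₁-part of the run E₁ of G₁ from T₁ would be a closed set of G
    -- containing T but not v.
    v-unreached-absurd : ∀ {k} → K T₁ ≤ℕ k → v ∉ closure G U₂ (θ₂ θ v k) T₂ → False
    v-unreached-absurd {k} K≤k v∉D₂ = v∉D (closed-is-all D-closed T⊆D v)
      where
      D₂ E₁ D : Subset n
      D₂ = closure G U₂ (θ₂ θ v k) T₂
      E₁ = closure G U₁ θ T₁
      D  = D₂ ∪ (E₁ ∩ W₁)

      D₂⊆U₂ : D₂ ⊆ U₂
      D₂⊆U₂ = Side₂.closure-⊆ k (p∩q⊆q T U₂)

      at-v : ∀ {w} → adj G v w ≡ true → w ∈ ⊤ → w ∈ D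
        → (w ∈ U₁ × w ∈ E₁) ⊎ (w ∈ U₂ × w ∈ D₂)
      at-v _ _ w∈D with x∈p∪q⁻ D₂ (E₁ ∩ W₁) w∈D
      ... | inj₁ w∈D₂ = inj₂ (D₂⊆U₂ w∈D₂ , w∈D₂)
      ... | inj₂ w∈E₁W₁ with x∈p∩q⁻ E₁ W₁ w∈E₁W₁
      ...   | w∈E₁ , w∈W₁ = inj₁ (W⊆⁅v⁆∪ W₁ w∈W₁ , w∈E₁)

      at-W₁ : ∀ {u w} → u ∈ W₁ → adj G u w ≡ true → w ∈ ⊤ → w ∈ D → w ∈ U₁ × w ∈ E₁
      at-W₁ u∈W₁ u~w _ w∈D with x∈p∪q⁻ D₂ (E₁ ∩ W₁) w∈D
      ... | inj₂ w∈E₁W₁ = nbr-W₁ u∈W₁ u~w , p∩q⊆p E₁ W₁ w∈E₁W₁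
      ... | inj₁ w∈D₂ with U₁∩U₂ (nbr-W₁ u∈W₁ u~w) (D₂⊆U₂ w∈D₂)
      ...   | refl = ⊥-elim (v∉D₂ w∈D₂)

      at-W₂ : ∀ {u w} → u ∈ W₂ → adj G u w ≡ true → w ∈ ⊤ → w ∈ D → w ∈ U₂ × w ∈ D₂
      at-W₂ u∈W₂ u~w _ w∈D with x∈p∪q⁻ D₂ (E₁ ∩ W₁) w∈D
      ... | inj₁ w∈D₂   = nbr-W₂ u∈W₂ u~w , w∈D₂
      ... | inj₂ w∈E₁W₁ = ⊥-elim (W₁∉U₂ (p∩q⊆q E₁ W₁ w∈E₁W₁) (nbr-W₂ u∈W₂ u~w))

      D-closed : Whole.Closed D
      D-closed u _ enough with location u
      ... | inj₁ refl = p⊆p∪q (E₁ ∩ W₁) (Side₂.closure-closed k T₂ v (v∈⁅v⁆∪ W₂)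
          (θ₂-at θ v k (shift⁺ (θ v) k _ (raise enough
            (ℕP.≤-trans (active-split G {⊤} {D} {U₁} {E₁} {U₂} {D₂} at-v) (ℕP.+-monoˡ-≤ _ K≤k))))))
      ... | inj₂ (inj₁ u∈W₁) = q⊆p∪q D₂ (E₁ ∩ W₁) (x∈p∩q⁺ (Side₁.closure-closed T₁ u (W⊆⁅v⁆∪ W₁ u∈W₁)
          (raise enough (active-local G {⊤} {D} {U₁} {E₁} (at-W₁ u∈W₁))) , u∈W₁))
      ... | inj₂ (inj₂ u∈W₂) = p⊆p∪q (E₁ ∩ W₁) (Side₂.closure-closed k T₂ u (W⊆⁅v⁆∪ W₂ u∈W₂)
          (θ₂-off θ v k (W₂-≢v u∈W₂)
                 (raise enough (active-local G {⊤} {D} {U₂} {D₂} (at-W₂ u∈W₂)))))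

      T⊆D : T ⊆ D
      T⊆D x∈T with T-split x∈T
      ... | inj₁ x∈T₁ = q⊆p∪q D₂ (E₁ ∩ W₁) (x∈p∩q⁺ (Side₁.⊆-closure T₁ x∈T₁ , p∩q⊆q T W₁ x∈T₁))
      ... | inj₂ x∈T₂ = p⊆p∪q (E₁ ∩ W₁) (Side₂.⊆-closure k T₂ x∈T₂)

      v∉D : v ∉ D
      v∉D v∈D with x∈p∪q⁻ D₂ (E₁ ∩ W₁) v∈D
      ... | inj₁ v∈D₂   = v∉D₂ v∈D₂
      ... | inj₂ v∈E₁W₁ = v∉W₁ (p∩q⊆q E₁ W₁ v∈E₁W₁)

    T₂-target : ∀ {k} → K T₁ ≤ℕ k → IsTargetSet G U₂ (θ₂ θ v k) T₂
    T₂-target {k} K≤k = extend-T₂ k (p∩q⊆q T U₂) (λ x∈T₂ → x∈T₂) v-reached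
      where
      v-reached : v ∈ closure G U₂ (θ₂ θ v k) T₂
      v-reached with v ∈? closure G U₂ (θ₂ θ v k) T₂
      ... | yes v∈D₂ = v∈D₂
      ... | no  v∉D₂ = ⊥-elim (v-unreached-absurd K≤k v∉D₂)

  -- If |T₁| ≤ |S₁| then T₁ is optimal for (G₁ - v, θ₁), so K T₁ ≤ K S₁ and
  -- T₂ is a target set for (G₂, θ₂); otherwise T₁ has a spare vertex, which
  -- pays for seeding v directly in G₂.
  seeds-bound : ∀ {S₁ S₂} → IsOptimal G W₁ (θ₁ G θ v) S₁
    → (∀ T → IsOptimal G W₁ (θ₁ G θ v) T → K T ≤ℕ K S₁)
    → IsOptimal G U₂ (θ₂ θ v (K S₁)) S₂
    → ∀ {T} → closure G ⊤ θ T ≡ ⊤ → ∣ S₁ ∣ +ℕ ∣ S₂ ∣ ≤ℕ ∣ T ∣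
  seeds-bound {S₁} {S₂} (_ , min₁) maxK (_ , min₂) {T} clT = by-size (∣ T₁ ∣ ℕP.≤? ∣ S₁ ∣)
    where
    open Restriction clT
    open ℕP.≤-Reasoning

    by-size : Dec (∣ T₁ ∣ ≤ℕ ∣ S₁ ∣) → ∣ S₁ ∣ +ℕ ∣ S₂ ∣ ≤ℕ ∣ T ∣
    by-size (yes ∣T₁∣≤∣S₁∣) = begin
      ∣ S₁ ∣ +ℕ ∣ S₂ ∣ ≤⟨ ℕP.+-mono-≤ (min₁ T₁ T₁-target) (min₂ T₂ (T₂-target (maxK T₁ T₁-optimal))) ⟩
      ∣ T₁ ∣ +ℕ ∣ T₂ ∣ ≤⟨ ∣T₁∣+∣T₂∣≤∣T∣ ⟩
      ∣ T ∣            ∎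
      where
      T₁-optimal : IsOptimal G W₁ (θ₁ G θ v) T₁
      T₁-optimal = T₁-target , λ T' T'-target → ℕP.≤-trans ∣T₁∣≤∣S₁∣ (min₁ T' T'-target)
    by-size (no ∣T₁∣≰∣S₁∣) = begin
      ∣ S₁ ∣ +ℕ ∣ S₂ ∣                   ≤⟨ ℕP.+-monoʳ-≤ ∣ S₁ ∣ (min₂ (T₂ ∪ ⁅ v ⁆) T₂+v-target) ⟩
      ∣ S₁ ∣ +ℕ ∣ T₂ ∪ ⁅ v ⁆ ∣           ≤⟨ ℕP.+-monoʳ-≤ ∣ S₁ ∣ (∣∪∣≤ T₂ ⁅ v ⁆) ⟩
      ∣ S₁ ∣ +ℕ (∣ T₂ ∣ +ℕ ∣ ⁅ v ⁆ ∣)    ≡⟨ cong (λ m → ∣ S₁ ∣ +ℕ (∣ T₂ ∣ +ℕ m)) (∣⁅x⁆∣≡1 v) ⟩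
      ∣ S₁ ∣ +ℕ (∣ T₂ ∣ +ℕ 1)            ≡⟨ cong (∣ S₁ ∣ +ℕ_) (ℕP.+-comm ∣ T₂ ∣ 1) ⟩
      ∣ S₁ ∣ +ℕ suc ∣ T₂ ∣               ≡⟨ ℕP.+-suc ∣ S₁ ∣ ∣ T₂ ∣ ⟩
      suc ∣ S₁ ∣ +ℕ ∣ T₂ ∣               ≤⟨ ℕP.+-monoˡ-≤ ∣ T₂ ∣ (ℕP.≰⇒> ∣T₁∣≰∣S₁∣) ⟩
      ∣ T₁ ∣ +ℕ ∣ T₂ ∣                   ≤⟨ ∣T₁∣+∣T₂∣≤∣T∣ ⟩
      ∣ T ∣                              ∎
      where
      T₂+v⊆U₂ : T₂ ∪ ⁅ v ⁆ ⊆ U₂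
      T₂+v⊆U₂ x∈ with x∈p∪q⁻ T₂ ⁅ v ⁆ x∈
      ... | inj₁ x∈T₂  = p∩q⊆q T U₂ x∈T₂
      ... | inj₂ x∈⁅v⁆ = p⊆p∪q W₂ x∈⁅v⁆

      T₂+v-target : IsTargetSet G U₂ (θ₂ θ v (K S₁)) (T₂ ∪ ⁅ v ⁆)
      T₂+v-target = extend-T₂ (K S₁) T₂+v⊆U₂ (p⊆p∪q ⁅ v ⁆)
        (Side₂.⊆-closure (K S₁) (T₂ ∪ ⁅ v ⁆) (q⊆p∪q T₂ ⁅ v ⁆ (x∈⁅x⁆ v)))

theorem2 : ∀ {n} (G : Graph n) (θ : Threshold n) (v : Fin n) (W₁ W₂ : Subset n)
    → Connected G
    → VertexSum G v W₁ W₂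
    → (S₁ : Subset n)
    → IsOptimal G W₁ (θ₁ G θ v) S₁
    → (∀ T → IsOptimal G W₁ (θ₁ G θ v) T
         → ∣ nbrs G (⁅ v ⁆ ∪ W₁) v ∩ closure G (⁅ v ⁆ ∪ W₁) θ T ∣
           ≤ℕ ∣ nbrs G (⁅ v ⁆ ∪ W₁) v ∩ closure G (⁅ v ⁆ ∪ W₁) θ S₁ ∣)
    → (S₂ : Subset n)
    → IsOptimal G (⁅ v ⁆ ∪ W₂)
        (θ₂ θ v ∣ nbrs G (⁅ v ⁆ ∪ W₁) v ∩ closure G (⁅ v ⁆ ∪ W₁) θ S₁ ∣) S₂
    → IsOptimal G ⊤ θ (S₁ ∪ S₂)
theorem2 G θ v W₁ W₂ _ VS S₁ opt₁@((_ , clS₁) , _) maxK S₂ opt₂@((_ , clS₂) , _) =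
  (⊆⊤ , union-activates clS₁ clS₂) ,
  λ T (_ , clT) → ℕP.≤-trans (∣∪∣≤ S₁ S₂) (seeds-bound opt₁ maxK opt₂ clT)
  where open VertexSumTargets G θ v W₁ W₂ VS
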